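{- Let $\vec{G}=(V,A)$ be an oriented graph. If $\vec{G}$ is $2$-freezable, then $|A|\ge 2|V|$.
   Context: An oriented graph is a digraph with no pair of opposite arcs $uv,vu$. A $k$-dicolouring is a map $V\to\{1,\dots,k\}$ with no monochromatic directed cycle; ${\cal D}_k(\vec{G})$ is the graph on the $k$-dicolourings, two adjacent if they differ on exactly one vertex. $\vec{G}$ is $k$-freezable if ${\cal D}_k(\vec{G})$ has an isolated vertex (a $k$-dicolouring in which no single vertex can be recoloured to obtain another $k$-dicolouring). -}

module Defs where

open import Data.Nat using (ℕ)
open import Data.Fin using (Fin)
open import Data.Product using (_×_; _,_; Σ; ∃)
open import Data.List using (List; []; _∷_; _++_; [_])
open import Data.List.Relation.Unary.All using (All)
open import Data.List.Relation.Unary.Unique.Propositional using (Unique)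
open import Data.List.Membership.Propositional using (_∈_)
open import Relation.Binary.PropositionalEquality using (_≡_; _≢_)
open import Relation.Nullary using (¬_)

-- A digraph on vertex set Fin n, given by its list of arcs (u , v) meaning u → v.
record Digraph : Set where
  constructor digraph
  field
    n    : ℕ
    arcs : List (Fin n × Fin n)
open Digraph public

record IsOriented (G : Digraph) : Set where
  field
    noDup      : Unique (arcs G)
    noLoop     : ∀ u → ¬ ((u , u) ∈ arcs G)
    noOpposite : ∀ u v → (u , v) ∈ arcs G → ¬ ((v , u) ∈ arcs G)

consecutive : {A : Set} → List A → List (A × A)
consecutive (x ∷ y ∷ r) = (x , y) ∷ consecutive (y ∷ r)
consecutive _ = []

-- A directed cycle x₀ x₁ … x_{k}, given by distinct vertices with arcs
-- x₀→x₁→…→x_k→x₀ (a nonempty list of distinct vertices).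
IsDicycle : (G : Digraph) → Fin (n G) → List (Fin (n G)) → Set
IsDicycle G x xs = Unique (x ∷ xs) × All (_∈ arcs G) (consecutive (x ∷ xs ++ [ x ]))

IsDicolouring : (G : Digraph) (k : ℕ) → (Fin (n G) → Fin k) → Set
IsDicolouring G k c =
  ∀ x xs → IsDicycle G x xs → ¬ All (λ v → c v ≡ c x) xs

DifferOnExactlyOne : {m k : ℕ} → (Fin m → Fin k) → (Fin m → Fin k) → Set
DifferOnExactlyOne {m} c c' = Σ (Fin m) λ v → (c v ≢ c' v) × (∀ w → w ≢ v → c w ≡ c' w)

-- k-freezable: D_k(G) has an isolated vertex
Freezable : (k : ℕ) (G : Digraph) → Set
Freezable k G = Σ (Fin (n G) → Fin k) λ c → IsDicolouring G k c ×
  (∀ c' → IsDicolouring G k c' → ¬ DifferOnExactlyOne c c')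

{-# OPTIONS --safe #-}
module Submission where

-- A frozen 2-dicolouring c forbids recolouring any vertex v, so toggling the colour of v
-- closes a dicycle through v, monochromatic in the new colour. Around v it supplies an arc
-- va and an arc yv with a, y coloured differently from v, and an arc ab with b coloured
-- like a (b ≠ v because G is oriented). Charge to v the arc va, and also an arc from v to
-- a vertex of its own colour, or the arc yv if v has none. Arcs of the first kind are
-- bichromatic into a vertex with an out-neighbour of its own colour; those of the second
-- kind are monochromatic, or bichromatic into a vertex without one, and determine v by
-- their tail resp. head. So the 2|V| charged arcs are distinct.
-- The dicycle is obtained only under double negation, which is harmless: V is finite and
-- the conclusion is decidable.

open import Defs
open import Data.Nat using (ℕ; _*_; _≤_; _≤?_)
open import Data.Fin using (Fin; zero; suc; _≟_; remQuot)
open import Data.Fin.Properties using (injective⇒≤; *↔×)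
open import Data.Product using (_×_; _,_; Σ; ∃; proj₁; proj₂)
open import Data.Sum using (inj₁; inj₂)
open import Data.List using (List; []; _∷_; _++_; [_]; length; lookup)
open import Data.List.Relation.Unary.All as All using (All)
open import Data.List.Relation.Unary.Any as Any using (here; there; any?)
open import Data.List.Relation.Unary.Any.Properties using (lookup-index)
open import Data.List.Membership.Propositional using (_∈_; find; lose)
open import Data.List.Membership.Propositional.Properties using (∈-++⁻; ∈-++⁺ʳ; ∈-++⁺ˡ)
open import Data.Vec.Functional using (updateAt)
open import Data.Vec.Functional.Properties using (updateAt-updates; updateAt-minimal)
open import Function using (_∘_)
open import Function.Bundles using (Injection)
open import Function.Definitions using (Injective)
open import Function.Properties.Inverse using (↔⇒↣)
open import Relation.Binary.PropositionalEquality
  using (_≡_; _≢_; refl; sym; trans; cong; subst; ≢-sym; module ≡-Reasoning)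
open import Relation.Nullary using (¬_; yes; no; contradiction)
open import Relation.Nullary.Decidable using (_×-dec_; decidable-stable)
open import Relation.Nullary.Negation using (¬¬-map)

module _ {X : Set} where

  ∈-consecutive⁻ : ∀ (l : List X) {p q} → (p , q) ∈ consecutive l → p ∈ l × q ∈ l
  ∈-consecutive⁻ (x ∷ y ∷ r) (here refl) = here refl , there (here refl)
  ∈-consecutive⁻ (x ∷ y ∷ r) (there m) with p∈ , q∈ ← ∈-consecutive⁻ (y ∷ r) m =
    there p∈ , there q∈

  ∈⇒successor : ∀ ys (z : X) {w} → w ∈ ys → ∃ λ a → (w , a) ∈ consecutive (ys ++ [ z ])
  ∈⇒successor (y ∷ [])      z (here refl) = z , here refl
  ∈⇒successor (y ∷ y′ ∷ ys) z (here refl) = y′ , here refl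
  ∈⇒successor (y ∷ y′ ∷ ys) z (there w∈) with a , m ← ∈⇒successor (y′ ∷ ys) z w∈ =
    a , there m

  ∈⇒predecessor : ∀ (y : X) ys {w} → w ∈ ys → ∃ λ a → (a , w) ∈ consecutive (y ∷ ys)
  ∈⇒predecessor y (y′ ∷ ys) (here refl) = y , here refl
  ∈⇒predecessor y (y′ ∷ ys) (there w∈) with a , m ← ∈⇒predecessor y′ ys w∈ =
    a , there m

  closedWalk : X → List X → List X
  closedWalk x xs = x ∷ xs ++ [ x ]

  closedWalk-successor : ∀ {x xs w} → w ∈ closedWalk x xs →
                         ∃ λ a → (w , a) ∈ consecutive (closedWalk x xs)
  closedWalk-successor {x} {xs} w∈ with ∈-++⁻ (x ∷ xs) w∈
  ... | inj₁ w∈x∷xs      = ∈⇒successor (x ∷ xs) x w∈x∷xs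
  ... | inj₂ (here refl) = ∈⇒successor (x ∷ xs) x (here refl)

  closedWalk-predecessor : ∀ {x xs w} → w ∈ closedWalk x xs →
                           ∃ λ a → (a , w) ∈ consecutive (closedWalk x xs)
  closedWalk-predecessor {x} {xs} (here refl) = ∈⇒predecessor x (xs ++ [ x ]) (∈-++⁺ʳ xs (here refl))
  closedWalk-predecessor {x} {xs} (there w∈)  = ∈⇒predecessor x (xs ++ [ x ]) w∈

  closedWalk-constant : ∀ {Y : Set} (f : X → Y) {x xs w} → All (λ u → f u ≡ f x) xs →
                        w ∈ closedWalk x xs → f w ≡ f x
  closedWalk-constant f {x} {xs} f≡ w∈ with ∈-++⁻ (x ∷ xs) w∈
  ... | inj₁ (here refl)  = refl
  ... | inj₁ (there w∈xs) = All.lookup f≡ w∈xs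
  ... | inj₂ (here refl)  = refl

  injection⇒≤length : ∀ {m} {xs : List X} (f : Fin m → X) → Injective _≡_ _≡_ f →
                      (∀ i → f i ∈ xs) → m ≤ length xs
  injection⇒≤length {xs = xs} f f-injective f∈ = injective⇒≤ index-injective
    where
    open ≡-Reasoning
    index-injective : Injective _≡_ _≡_ (Any.index ∘ f∈)
    index-injective {i} {j} eq = f-injective (begin
      f i                            ≡⟨ lookup-index (f∈ i) ⟩
      lookup xs (Any.index (f∈ i))   ≡⟨ cong (lookup xs) eq ⟩
      lookup xs (Any.index (f∈ j))   ≡⟨ lookup-index (f∈ j) ⟨
      f j                            ∎)

¬¬-∀-Fin : ∀ {m} {P : Fin m → Set} → (∀ i → ¬ ¬ P i) → ¬ ¬ (∀ i → P i)
¬¬-∀-Fin {ℕ.zero}  ¬¬P ¬∀P = ¬∀P λ ()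
¬¬-∀-Fin {ℕ.suc m} ¬¬P ¬∀P = ¬¬P zero λ P0 → ¬¬-∀-Fin (¬¬P ∘ suc) λ P-suc →
  ¬∀P λ { zero → P0 ; (suc i) → P-suc i }

toggle : Fin 2 → Fin 2
toggle zero       = suc zero
toggle (suc zero) = zero

toggle-≢ : ∀ i → toggle i ≢ i
toggle-≢ zero       ()
toggle-≢ (suc zero) ()

toggleAt : ∀ {m} → (Fin m → Fin 2) → Fin m → Fin m → Fin 2
toggleAt c v = updateAt c v toggle

toggleAt-differs : ∀ {m} (c : Fin m → Fin 2) v → DifferOnExactlyOne c (toggleAt c v)
toggleAt-differs c v =
  v , (λ eq → toggle-≢ (c v) (trans (sym (updateAt-updates v c)) (sym eq))) ,
  λ w w≢v → sym (updateAt-minimal w v c w≢v)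

module _ {G : Digraph} (oriented : IsOriented G) where
  open IsOriented oriented

  arc⇒≢ : ∀ {u w} → (u , w) ∈ arcs G → u ≢ w
  arc⇒≢ {u} u→w refl = noLoop u u→w

  path₂⇒≢ : ∀ {u w z} → (u , w) ∈ arcs G → (w , z) ∈ arcs G → u ≢ z
  path₂⇒≢ {u} {w} u→w w→u refl = noOpposite u w u→w w→u

record Blocked (G : Digraph) {k} (c : Fin (n G) → Fin k) (v : Fin (n G)) : Set where
  field
    out mid inn : Fin (n G)
    out-arc     : (v , out) ∈ arcs G
    mid-arc     : (out , mid) ∈ arcs G
    in-arc      : (inn , v) ∈ arcs G
    out-colour  : c out ≢ c v
    mid-colour  : c mid ≡ c out
    in-colour   : c inn ≢ c v

module _ {G : Digraph} (oriented : IsOriented G) (c : Fin (n G) → Fin 2) (v : Fin (n G)) where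
  open import Data.List.Membership.DecPropositional (_≟_ {n G}) using (_∈?_)

  monochromatic-cycle-through⇒blocked : ∀ {x xs} → IsDicycle G x xs →
    All (λ w → toggleAt c v w ≡ toggleAt c v x) xs → v ∈ closedWalk x xs → Blocked G c v
  monochromatic-cycle-through⇒blocked {x} {xs} (_ , cycle-arcs) mono v∈
    with a , v→a ← closedWalk-successor v∈
    with b , a→b ← closedWalk-successor (proj₂ (∈-consecutive⁻ _ v→a))
    with y , y→v ← closedWalk-predecessor v∈
    = record
      { out = a ; mid = b ; inn = y
      ; out-arc    = arc v→a
      ; mid-arc    = arc a→b
      ; in-arc     = arc y→v
      ; out-colour = ≢-colour (toggled a∈ v≢a)
      ; mid-colour = trans (toggled b∈ v≢b) (sym (toggled a∈ v≢a))
      ; in-colour  = ≢-colour (toggled y∈ (≢-sym (arc⇒≢ oriented (arc y→v))))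
      }
    where
    open ≡-Reasoning
    arc : ∀ {e} → e ∈ consecutive (closedWalk x xs) → e ∈ arcs G
    arc = All.lookup cycle-arcs
    a∈ : a ∈ closedWalk x xs
    a∈ = proj₂ (∈-consecutive⁻ _ v→a)
    b∈ : b ∈ closedWalk x xs
    b∈ = proj₂ (∈-consecutive⁻ _ a→b)
    y∈ : y ∈ closedWalk x xs
    y∈ = proj₁ (∈-consecutive⁻ _ y→v)
    v≢a : v ≢ a
    v≢a = arc⇒≢ oriented (arc v→a)
    v≢b : v ≢ b
    v≢b = path₂⇒≢ oriented (arc v→a) (arc a→b)
    toggled : ∀ {w} → w ∈ closedWalk x xs → v ≢ w → c w ≡ toggle (c v)
    toggled {w} w∈ v≢w = begin
      c w             ≡⟨ updateAt-minimal w v c (≢-sym v≢w) ⟨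
      toggleAt c v w  ≡⟨ closedWalk-constant (toggleAt c v) mono w∈ ⟩
      toggleAt c v x  ≡⟨ closedWalk-constant (toggleAt c v) mono v∈ ⟨
      toggleAt c v v  ≡⟨ updateAt-updates v c ⟩
      toggle (c v)    ∎
    ≢-colour : ∀ {w} → c w ≡ toggle (c v) → c w ≢ c v
    ≢-colour eq eq′ = toggle-≢ (c v) (trans (sym eq) eq′)

  toggleAt-dicolouring : IsDicolouring G 2 c → ¬ Blocked G c v → IsDicolouring G 2 (toggleAt c v)
  toggleAt-dicolouring dicolouring unblocked x xs cycle mono with v ∈? (x ∷ xs)
  ... | yes v∈ = unblocked (monochromatic-cycle-through⇒blocked cycle mono (∈-++⁺ˡ v∈))
  ... | no  v∉ = dicolouring x xs cycle (All.tabulate monochromatic)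
    where
    open ≡-Reasoning
    unchanged : ∀ {w} → w ∈ x ∷ xs → toggleAt c v w ≡ c w
    unchanged w∈ = updateAt-minimal _ v c λ { refl → v∉ w∈ }
    monochromatic : ∀ {w} → w ∈ xs → c w ≡ c x
    monochromatic {w} w∈ = begin
      c w             ≡⟨ unchanged (there w∈) ⟨
      toggleAt c v w  ≡⟨ All.lookup mono w∈ ⟩
      toggleAt c v x  ≡⟨ unchanged (here refl) ⟩
      c x             ∎

  frozen⇒¬¬blocked : IsDicolouring G 2 c →
    (∀ d → IsDicolouring G 2 d → ¬ DifferOnExactlyOne c d) → ¬ ¬ Blocked G c v
  frozen⇒¬¬blocked dicolouring frozen unblocked =
    frozen (toggleAt c v) (toggleAt-dicolouring dicolouring unblocked) (toggleAt-differs c v)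

module _ (G : Digraph) {k} (c : Fin (n G) → Fin k) (blocked : ∀ v → Blocked G c v) where
  open Blocked

  private
    N : ℕ
    N = n G
    A : List (Fin N × Fin N)
    A = arcs G

  Sink : Fin N → Set
  Sink v = ∀ w → (v , w) ∈ A → c w ≢ c v

  data SecondArc (v : Fin N) : Fin N × Fin N → Set where
    monochromatic-out   : ∀ {w} → c w ≡ c v → SecondArc v (v , w)
    bichromatic-in-sink : ∀ {u} → c u ≢ c v → Sink v → SecondArc v (u , v)

  secondArc : ∀ v → Σ (Fin N × Fin N) λ e → e ∈ A × SecondArc v e
  secondArc v with any? (λ e → (proj₁ e ≟ v) ×-dec (c (proj₂ e) ≟ c v)) A
  ... | yes found with (.v , w) , w∈ , refl , cw≡cv ← find found =
    (v , w) , w∈ , monochromatic-out cw≡cv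
  ... | no  none =
    (inn (blocked v) , v) , in-arc (blocked v) ,
    bichromatic-in-sink (in-colour (blocked v)) λ w v→w cw≡cv → none (lose v→w (refl , cw≡cv))

  secondArc-unique : ∀ {v w e} → SecondArc v e → SecondArc w e → v ≡ w
  secondArc-unique (monochromatic-out _)       (monochromatic-out _)       = refl
  secondArc-unique (monochromatic-out eq)      (bichromatic-in-sink neq _) = contradiction (sym eq) neq
  secondArc-unique (bichromatic-in-sink neq _) (monochromatic-out eq)      = contradiction (sym eq) neq
  secondArc-unique (bichromatic-in-sink _ _)   (bichromatic-in-sink _ _)   = refl

  firstArc-not-second : ∀ v {w} → ¬ SecondArc w (v , out (blocked v))
  firstArc-not-second v (monochromatic-out eq)       = out-colour (blocked v) eq
  firstArc-not-second v (bichromatic-in-sink _ sink) =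
    sink (mid (blocked v)) (mid-arc (blocked v)) (mid-colour (blocked v))

  charge : Fin 2 × Fin N → Fin N × Fin N
  charge (zero     , v) = v , out (blocked v)
  charge (suc zero , v) = proj₁ (secondArc v)

  charge-∈ : ∀ i → charge i ∈ A
  charge-∈ (zero     , v) = out-arc (blocked v)
  charge-∈ (suc zero , v) = proj₁ (proj₂ (secondArc v))

  charge-second : ∀ v → SecondArc v (charge (suc zero , v))
  charge-second v = proj₂ (proj₂ (secondArc v))

  charge-injective : Injective _≡_ _≡_ charge
  charge-injective {zero     , v} {zero     , w} refl = refl
  charge-injective {zero     , v} {suc zero , w} eq   =
    contradiction (subst (SecondArc w) (sym eq) (charge-second w)) (firstArc-not-second v)
  charge-injective {suc zero , v} {zero     , w} eq   =
    contradiction (subst (SecondArc v) eq (charge-second v)) (firstArc-not-second w)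
  charge-injective {suc zero , v} {suc zero , w} eq
    with refl ← secondArc-unique (charge-second v) (subst (SecondArc w) (sym eq) (charge-second w))
    = refl

  blocked⇒2n≤arcs : 2 * N ≤ length A
  blocked⇒2n≤arcs = injection⇒≤length (charge ∘ remQuot N)
    (Injection.injective (↔⇒↣ (*↔× {2} {N})) ∘ charge-injective) (charge-∈ ∘ remQuot N)

theorem14 : (G : Digraph) → IsOriented G → Freezable 2 G → 2 * n G ≤ length (arcs G)
theorem14 G oriented (c , dicolouring , frozen) =
  decidable-stable (2 * n G ≤? length (arcs G))
    (¬¬-map (blocked⇒2n≤arcs G c)
      (¬¬-∀-Fin λ v → frozen⇒¬¬blocked oriented c v dicolouring frozen))
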